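{- Let $n$ be a positive integer, let $C_n$ be the cyclic group of order $n$, and let $x \in C_n$ have order $\mathrm{o}(x)$. Let $[x]$ denote the set of generators of the cyclic subgroup $\langle x\rangle$. Then, in the power graph $\mathcal{P}(C_n)$, $$|N([x])| = \mathrm{o}(x) - 2\,\phi(\mathrm{o}(x)) + \sum_{d \,\mid\, \frac{n}{\mathrm{o}(x)}} \phi\!\left(\frac{n}{d}\right),$$ where $\phi$ is Euler's totient function and the sum is over positive divisors $d$ of $n/\mathrm{o}(x)$.
   Context: The power graph $\mathcal{P}(G)$ of a group $G$ is the simple undirected graph with vertex set $G$ in which two distinct vertices are adjacent if one of them is a positive power of the other. For a set $A$ of vertices of a graph, $N(A)$ denotes the set of all vertices not in $A$ that are adjacent to some vertex of $A$. -}

module Defs where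

open import Data.Nat using (ℕ; zero; suc; _+_; _*_; _<_; _≤_; NonZero)
open import Data.Nat.DivMod using (_mod_)
open import Data.Nat.Divisibility using (_∣?_)
open import Data.Nat.Coprimality using (coprime?)
open import Data.Fin using (Fin; toℕ)
open import Data.List using (List; length; filter; map; upTo)
open import Data.Nat.ListAction using (sum)
open import Data.List.Membership.Propositional using (_∈_)
open import Data.List.Relation.Unary.Unique.Propositional using (Unique)
open import Data.Product using (Σ; ∃; _×_)
open import Data.Sum using (_⊎_)
open import Relation.Binary.PropositionalEquality using (_≡_; _≢_)
open import Relation.Nullary using (¬_)
open import Function.Bundles using (_⇔_)

module Cyclic (n : ℕ) .{{_ : NonZero n}} where

  C : Set
  C = Fin n

  e : C
  e = 0 mod n

  _⊕_ : C → C → C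
  x ⊕ y = (toℕ x + toℕ y) mod n

  pow : ℕ → C → C
  pow zero    x = e
  pow (suc k) x = x ⊕ pow k x

  PosPow : C → C → Set
  PosPow x y = ∃ λ k → 1 ≤ k × pow k x ≡ y

  Adj : C → C → Set
  Adj x y = x ≢ y × (PosPow x y ⊎ PosPow y x)

  InSub : C → C → Set
  InSub x z = ∃ λ k → pow k x ≡ z

  Gen : C → C → Set
  Gen x y = ∀ z → InSub y z ⇔ InSub x z

  Nbhd : (C → Set) → C → Set
  Nbhd A y = ¬ A y × ∃ λ z → A z × Adj z y

  IsOrder : C → ℕ → Set
  IsOrder x o = 1 ≤ o × pow o x ≡ e × (∀ k → 1 ≤ k → pow k x ≡ e → o ≤ k)

HasSize : {A : Set} → (A → Set) → ℕ → Set
HasSize {A} P m =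
  Σ (List A) λ xs → Unique xs × length xs ≡ m × (∀ y → (y ∈ xs) ⇔ P y)

range1 : ℕ → List ℕ
range1 m = map suc (upTo m)

φ : ℕ → ℕ
φ m = length (filter (λ k → coprime? k m) (range1 m))

-- sum of f d over the positive divisors d of q
-- (d ranges over 1..q, written d = suc k, so f may divide by d)
divisorSum : ℕ → ((d : ℕ) → .{{NonZero d}} → ℕ) → ℕ
divisorSum q f =
  sum (map (λ k → f (suc k)) (filter (λ k → suc k ∣? q) (upTo q)))

-- In ℤ/nℤ the cyclic subgroup ⟨y⟩ is the set of multiples of gcd(y, n), so everything
-- about the power graph is governed by g(y) = gcd(y, n): for x of order o we have
-- g(x) = q = n/o, the generators [x] are the y with g(y) = q, and y is adjacent to [x]
-- exactly when q ∣ y (y is a power of x) or g(y) ∣ q (x is a power of y).  Both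
-- conditions hold precisely on [x], so by inclusion–exclusion
--   |N([x])| + 2|[x]| = #{y : q ∣ y} + #{y : g(y) ∣ q} = o + Σ_{d ∣ q} #{y : g(y) = d},
-- and #{y < n : gcd(y, n) = d} = φ(n/d), which also gives |[x]| = φ(o).

module Submission where

open import Defs
open import Data.Bool using (true; false; if_then_else_)
open import Data.Empty using (⊥-elim)
open import Data.Fin using (Fin; toℕ)
open import Data.Fin.Properties using (toℕ-injective; toℕ<n; toℕ-fromℕ<)
open import Data.List using ([]; _∷_; length; filter; map; applyUpTo; upTo; tabulate; allFin)
open import Data.List.Properties using (map-∘; map-upTo; map-tabulate)
open import Data.List.Membership.Propositional.Properties using (∈-filter⁻; ∈-filter⁺; ∈-allFin)
open import Data.List.Relation.Unary.Unique.Propositional.Properties using (filter⁺; allFin⁺)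
open import Data.Nat
open import Data.Nat.Properties
open import Algebra.Properties.CommutativeSemigroup +-commutativeSemigroup
  using () renaming (interchange to +-interchange)
open import Algebra.Properties.CommutativeSemigroup *-commutativeSemigroup
  using (x∙yz≈y∙xz)
open import Data.Nat.Coprimality using (coprime?)
open import Data.Nat.DivMod using (m≡m%n+[m/n]*n; [m+kn]%n≡m%n; %-distribˡ-*; m<n⇒m%n≡m; m/n*n≡m)
open import Data.Nat.Divisibility
open import Data.Nat.GCD
open import Data.Nat.ListAction using (sum)
open import Data.Nat.Tactic.RingSolver using (solve-∀)
open import Data.Product using (∃; _×_; _,_; proj₂)
open import Data.Sum using (_⊎_; inj₂) renaming (map to ⊎-map)
open import Function using (_∘_; it; _⇔_; mk⇔; Equivalence)
open import Function.Properties.Equivalence using () renaming (trans to ⇔-trans)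
open import Relation.Nullary using (¬_; Dec; yes; no; does)
open import Relation.Nullary.Decidable using (_×-dec_; _⊎-dec_; ¬?)
open import Relation.Unary using (Decidable)
open import Relation.Binary.PropositionalEquality

open Equivalence using (to; from)

-- Sums over initial segments of ℕ

∑< : ℕ → (ℕ → ℕ) → ℕ
∑< N f = sum (applyUpTo f N)

syntax ∑< N (λ i → x) = ∑[ i < N ] x

∑-cong : ∀ {f g} N → (∀ i → f i ≡ g i) → ∑[ i < N ] f i ≡ ∑[ i < N ] g i
∑-cong zero    f≗g = refl
∑-cong {f} {g} (suc N) f≗g = cong₂ _+_ (f≗g 0) (∑-cong {f ∘ suc} {g ∘ suc} N (f≗g ∘ suc))

∑-zero : ∀ f N → (∀ i → i < N → f i ≡ 0) → ∑[ i < N ] f i ≡ 0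
∑-zero f zero    f≡0 = refl
∑-zero f (suc N) f≡0 = cong₂ _+_ (f≡0 0 z<s) (∑-zero (f ∘ suc) N λ i i<N → f≡0 (suc i) (s<s i<N))

∑-const : ∀ N c → ∑[ i < N ] c ≡ N * c
∑-const zero    c = refl
∑-const (suc N) c = cong (c +_) (∑-const N c)

∑-distrib-+ : ∀ f g N → ∑[ i < N ] (f i + g i) ≡ ∑[ i < N ] f i + ∑[ i < N ] g i
∑-distrib-+ f g zero    = refl
∑-distrib-+ f g (suc N) = begin
  (f 0 + g 0) + ∑[ i < N ] (f (suc i) + g (suc i))
    ≡⟨ cong (f 0 + g 0 +_) (∑-distrib-+ (f ∘ suc) (g ∘ suc) N) ⟩
  (f 0 + g 0) + (∑[ i < N ] f (suc i) + ∑[ i < N ] g (suc i))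
    ≡⟨ +-interchange (f 0) (g 0) _ _ ⟩
  (f 0 + ∑[ i < N ] f (suc i)) + (g 0 + ∑[ i < N ] g (suc i)) ∎
  where open ≡-Reasoning

*-distribˡ-∑ : ∀ c f N → c * ∑[ i < N ] f i ≡ ∑[ i < N ] (c * f i)
*-distribˡ-∑ c f zero    = *-zeroʳ c
*-distribˡ-∑ c f (suc N) =
  trans (*-distribˡ-+ c (f 0) _) (cong (c * f 0 +_) (*-distribˡ-∑ c (f ∘ suc) N))

∑-split : ∀ f M N → ∑[ i < M + N ] f i ≡ ∑[ i < M ] f i + ∑[ j < N ] f (M + j)
∑-split f zero    N = refl
∑-split f (suc M) N =
  trans (cong (f 0 +_) (∑-split (f ∘ suc) M N)) (sym (+-assoc (f 0) _ _))

∑-last : ∀ f N → ∑[ i < suc N ] f i ≡ ∑[ i < N ] f i + f N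
∑-last f zero    = +-comm (f 0) 0
∑-last f (suc N) =
  trans (cong (f 0 +_) (∑-last (f ∘ suc) N)) (sym (+-assoc (f 0) _ _))

∑-rotate : ∀ f N → f 0 ≡ f N → ∑[ i < N ] f (suc i) ≡ ∑[ i < N ] f i
∑-rotate f N f0≡fN = +-cancelˡ-≡ (f 0) _ _ (begin
  f 0 + ∑[ i < N ] f (suc i)  ≡⟨ ∑-last f N ⟩
  ∑[ i < N ] f i + f N        ≡⟨ cong (∑[ i < N ] f i +_) (sym f0≡fN) ⟩
  ∑[ i < N ] f i + f 0        ≡⟨ +-comm _ (f 0) ⟩
  f 0 + ∑[ i < N ] f i        ∎)
  where open ≡-Reasoning

∑-comm : ∀ M N (f : ℕ → ℕ → ℕ) →
         ∑[ i < M ] ∑[ j < N ] f i j ≡ ∑[ j < N ] ∑[ i < M ] f i j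
∑-comm zero    N f = sym (∑-zero (λ _ → 0) N λ _ _ → refl)
∑-comm (suc M) N f = begin
  ∑[ j < N ] f 0 j + ∑[ i < M ] ∑[ j < N ] f (suc i) j
    ≡⟨ cong (∑[ j < N ] f 0 j +_) (∑-comm M N (f ∘ suc)) ⟩
  ∑[ j < N ] f 0 j + ∑[ j < N ] ∑[ i < M ] f (suc i) j
    ≡⟨ ∑-distrib-+ (f 0) (λ j → ∑[ i < M ] f (suc i) j) N ⟨
  ∑[ j < N ] (f 0 j + ∑[ i < M ] f (suc i) j) ∎
  where open ≡-Reasoning

∑-single : ∀ f c N → (∀ i → i ≢ c → f i ≡ 0) → (N ≤ c → f c ≡ 0) →
           ∑[ i < N ] f i ≡ f c
∑-single f c       zero    _   out = sym (out z≤n)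
∑-single f zero    (suc N) f≡0 _   =
  trans (cong (f 0 +_) (∑-zero (f ∘ suc) N λ i _ → f≡0 (suc i) λ ())) (+-identityʳ (f 0))
∑-single f (suc c) (suc N) f≡0 out = cong₂ _+_ (f≡0 0 λ ())
  (∑-single (f ∘ suc) c N (λ i i≢c → f≡0 (suc i) (i≢c ∘ suc-injective)) (out ∘ s≤s))

∑-multiples : ∀ d .{{_ : NonZero d}} m (f : ℕ → ℕ) → (∀ y → ¬ d ∣ y → f y ≡ 0) →
              ∑[ y < m * d ] f y ≡ ∑[ k < m ] f (k * d)
∑-multiples d         zero    f f≡0 = refl
∑-multiples d@(suc d′) (suc m) f f≡0 = begin
  ∑[ y < d + m * d ] f y
    ≡⟨ ∑-split f d (m * d) ⟩
  ∑[ y < d ] f y + ∑[ y < m * d ] f (d + y)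
    ≡⟨ cong₂ _+_ firstBlock (∑-multiples d m (f ∘ (d +_)) shifted-f≡0) ⟩
  f 0 + ∑[ k < m ] f (d + k * d) ∎
  where
  open ≡-Reasoning
  firstBlock : ∑[ y < d ] f y ≡ f 0
  firstBlock = trans
    (cong (f 0 +_) (∑-zero (f ∘ suc) d′ λ i i<d′ → f≡0 (suc i) λ d∣1+i → <⇒≱ (s<s i<d′) (∣⇒≤ d∣1+i)))
    (+-identityʳ (f 0))
  shifted-f≡0 : ∀ y → ¬ d ∣ y → f (d + y) ≡ 0
  shifted-f≡0 y d∤y = f≡0 (d + y) λ d∣d+y → d∤y (∣m+n∣m⇒∣n d∣d+y ∣-refl)

-- Indicators of decidable propositions, and counting

-- Defined through 'does' so that ⟦ coprime? k m ⟧ reduces to ⟦ gcd k m ≟ 1 ⟧.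
⟦_⟧ : ∀ {p} {P : Set p} → Dec P → ℕ
⟦ P? ⟧ = if does P? then 1 else 0

module _ {p} {P : Set p} where

  ⟦⟧-yes : (P? : Dec P) → P → ⟦ P? ⟧ ≡ 1
  ⟦⟧-yes (yes _) _  = refl
  ⟦⟧-yes (no ¬p) p  = ⊥-elim (¬p p)

  ⟦⟧-no : (P? : Dec P) → ¬ P → ⟦ P? ⟧ ≡ 0
  ⟦⟧-no (yes p) ¬p = ⊥-elim (¬p p)
  ⟦⟧-no (no _)  _  = refl

  ⟦⟧-*-cong : ∀ {a b} (P? : Dec P) → (P → a ≡ b) → ⟦ P? ⟧ * a ≡ ⟦ P? ⟧ * b
  ⟦⟧-*-cong (yes p) a≡b = cong (_+ 0) (a≡b p)
  ⟦⟧-*-cong (no _)  _   = refl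

⟦⟧-cong : ∀ {p q} {P : Set p} {Q : Set q} (P? : Dec P) (Q? : Dec Q) → P ⇔ Q → ⟦ P? ⟧ ≡ ⟦ Q? ⟧
⟦⟧-cong (yes p) Q? P⇔Q = sym (⟦⟧-yes Q? (P⇔Q .to p))
⟦⟧-cong (no ¬p) Q? P⇔Q = sym (⟦⟧-no Q? (¬p ∘ P⇔Q .from))

⟦⟧-inclusion-exclusion : ∀ {E A B : Set} (E? : Dec E) (A? : Dec A) (B? : Dec B) → E ⇔ (A × B) →
  ⟦ ¬? E? ×-dec (A? ⊎-dec B?) ⟧ + 2 * ⟦ E? ⟧ ≡ ⟦ A? ⟧ + ⟦ B? ⟧
⟦⟧-inclusion-exclusion (yes e) A? B? E⇔AB with E⇔AB .to e
... | a , b rewrite ⟦⟧-yes A? a | ⟦⟧-yes B? b = refl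
⟦⟧-inclusion-exclusion (no ¬e) (yes a) (yes b) E⇔AB = ⊥-elim (¬e (E⇔AB .from (a , b)))
⟦⟧-inclusion-exclusion (no ¬e) (yes a) (no ¬b) E⇔AB = refl
⟦⟧-inclusion-exclusion (no ¬e) (no ¬a) (yes b) E⇔AB = refl
⟦⟧-inclusion-exclusion (no ¬e) (no ¬a) (no ¬b) E⇔AB = refl

module _ {a p} {A : Set a} {P : A → Set p} (P? : Decidable P) where

  length-filter : ∀ xs → length (filter P? xs) ≡ sum (map (⟦_⟧ ∘ P?) xs)
  length-filter []       = refl
  length-filter (x ∷ xs) with does (P? x)
  ... | true  = cong suc (length-filter xs)
  ... | false = length-filter xs

  sum-map-filter : ∀ f xs → sum (map f (filter P? xs)) ≡ sum (map (λ x → ⟦ P? x ⟧ * f x) xs)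
  sum-map-filter f []       = refl
  sum-map-filter f (x ∷ xs) with does (P? x)
  ... | true  = cong₂ _+_ (sym (+-identityʳ (f x))) (sum-map-filter f xs)
  ... | false = sum-map-filter f xs

sum-tabulate-toℕ : ∀ n f → sum (tabulate {n = n} (f ∘ toℕ)) ≡ ∑[ i < n ] f i
sum-tabulate-toℕ zero    f = refl
sum-tabulate-toℕ (suc n) f = cong (f 0 +_) (sum-tabulate-toℕ n (f ∘ suc))

length-filter-allFin : ∀ n {p} {P : ℕ → Set p} (P? : Decidable P) →
  length (filter (P? ∘ toℕ) (allFin n)) ≡ ∑[ i < n ] ⟦ P? i ⟧
length-filter-allFin n P? = trans (length-filter (P? ∘ toℕ) (allFin n))
  (trans (cong sum (map-tabulate {n = n} (λ i → i) (⟦_⟧ ∘ P? ∘ toℕ)))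
         (sum-tabulate-toℕ n (⟦_⟧ ∘ P?)))

HasSize-filter : ∀ {n} {p} {P : Fin n → Set p} {Q : Fin n → Set} (P? : Decidable P) →
  (∀ y → Q y ⇔ P y) → HasSize Q (length (filter P? (allFin n)))
HasSize-filter {n} P? Q⇔P = filter P? (allFin n) , filter⁺ P? (allFin⁺ n) , refl , λ y → mk⇔
  (λ y∈ → Q⇔P y .from (proj₂ (∈-filter⁻ P? {xs = allFin n} y∈)))
  (λ Qy → ∈-filter⁺ P? (∈-allFin y) (Q⇔P y .to Qy))


-- Counting residues by their gcd with n

-- φ ranges over 1 ≤ k ≤ m, the sum over 0 ≤ k < m; the end points agree as gcd 0 m ≡ m ≡ gcd m m.
φ≡∑-coprime : ∀ m → φ m ≡ ∑[ k < m ] ⟦ gcd k m ≟ 1 ⟧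
φ≡∑-coprime m = begin
  length (filter (λ k → coprime? k m) (map suc (upTo m)))
    ≡⟨ length-filter (λ k → coprime? k m) (map suc (upTo m)) ⟩
  sum (map (λ k → ⟦ coprime? k m ⟧) (map suc (upTo m)))
    ≡⟨ cong sum (trans (sym (map-∘ (upTo m))) (map-upTo _ m)) ⟩
  ∑[ k < m ] ⟦ gcd (suc k) m ≟ 1 ⟧
    ≡⟨ ∑-rotate (λ k → ⟦ gcd k m ≟ 1 ⟧) m (cong (λ g → ⟦ g ≟ 1 ⟧) gcd[0,m]≡gcd[m,m]) ⟩
  ∑[ k < m ] ⟦ gcd k m ≟ 1 ⟧ ∎
  where
  open ≡-Reasoning
  gcd[0,m]≡gcd[m,m] : gcd 0 m ≡ gcd m m
  gcd[0,m]≡gcd[m,m] = trans (gcd-identityˡ m) (∣-antisym (gcd-greatest ∣-refl ∣-refl) (gcd[m,n]∣m m m))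

∑[gcd≡d]≡φ : ∀ d .{{_ : NonZero d}} m N → m * d ≡ N → ∑[ y < N ] ⟦ gcd y N ≟ d ⟧ ≡ φ m
∑[gcd≡d]≡φ d m _ refl = begin
  ∑[ y < m * d ] ⟦ gcd y (m * d) ≟ d ⟧
    ≡⟨ ∑-multiples d m _ (λ y d∤y → ⟦⟧-no (gcd y (m * d) ≟ d) (d∤y ∘ gcd≡d⇒d∣ y)) ⟩
  ∑[ k < m ] ⟦ gcd (k * d) (m * d) ≟ d ⟧
    ≡⟨ ∑-cong m (λ k → ⟦⟧-cong (gcd (k * d) (m * d) ≟ d) (gcd k m ≟ 1) (gcd[kd,md]≡d⇔gcd[k,m]≡1 k)) ⟩
  ∑[ k < m ] ⟦ gcd k m ≟ 1 ⟧
    ≡⟨ φ≡∑-coprime m ⟨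
  φ m ∎
  where
  open ≡-Reasoning
  gcd≡d⇒d∣ : ∀ y → gcd y (m * d) ≡ d → d ∣ y
  gcd≡d⇒d∣ y gcd≡d = subst (_∣ y) gcd≡d (gcd[m,n]∣m y (m * d))
  gcd[kd,md]≡d*gcd[k,m] : ∀ k → gcd (k * d) (m * d) ≡ d * gcd k m
  gcd[kd,md]≡d*gcd[k,m] k =
    trans (cong₂ gcd (*-comm k d) (*-comm m d)) (sym (c*gcd[m,n]≡gcd[cm,cn] d k m))
  gcd[kd,md]≡d⇔gcd[k,m]≡1 : ∀ k → gcd (k * d) (m * d) ≡ d ⇔ gcd k m ≡ 1
  gcd[kd,md]≡d⇔gcd[k,m]≡1 k = mk⇔
    (λ eq → *-cancelˡ-≡ _ _ d (trans (sym (gcd[kd,md]≡d*gcd[k,m] k)) (trans eq (sym (*-identityʳ d)))))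
    (λ eq → trans (gcd[kd,md]≡d*gcd[k,m] k) (trans (cong (d *_) eq) (*-identityʳ d)))

∑[d∣y]≡m : ∀ d .{{_ : NonZero d}} m → ∑[ y < m * d ] ⟦ d ∣? y ⟧ ≡ m
∑[d∣y]≡m d m = begin
  ∑[ y < m * d ] ⟦ d ∣? y ⟧    ≡⟨ ∑-multiples d m _ (λ y → ⟦⟧-no (d ∣? y)) ⟩
  ∑[ k < m ] ⟦ d ∣? k * d ⟧   ≡⟨ ∑-cong m (λ k → ⟦⟧-yes (d ∣? k * d) (n∣m*n k)) ⟩
  ∑[ k < m ] 1                ≡⟨ ∑-const m 1 ⟩
  m * 1                       ≡⟨ *-identityʳ m ⟩
  m                           ∎
  where open ≡-Reasoning

divisorSum≡∑ : ∀ q f → divisorSum q f ≡ ∑[ k < q ] (⟦ suc k ∣? q ⟧ * f (suc k))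
divisorSum≡∑ q f = trans
  (sum-map-filter (λ k → suc k ∣? q) (λ k → f (suc k)) (upTo q))
  (cong sum (map-upTo _ q))

∑[d∣q]⟦g≡d⟧≡⟦g∣q⟧ : ∀ q .{{_ : NonZero q}} g →
  ∑[ k < q ] (⟦ suc k ∣? q ⟧ * ⟦ g ≟ suc k ⟧) ≡ ⟦ g ∣? q ⟧
∑[d∣q]⟦g≡d⟧≡⟦g∣q⟧ q zero = begin
  ∑[ k < q ] (⟦ suc k ∣? q ⟧ * 0)  ≡⟨ ∑-zero _ q (λ k _ → *-zeroʳ ⟦ suc k ∣? q ⟧) ⟩
  0                               ≡⟨ ⟦⟧-no (0 ∣? q) (≢-nonZero⁻¹ q ∘ 0∣⇒≡0) ⟨
  ⟦ 0 ∣? q ⟧                      ∎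
  where open ≡-Reasoning
∑[d∣q]⟦g≡d⟧≡⟦g∣q⟧ q (suc c) = begin
  ∑[ k < q ] (⟦ suc k ∣? q ⟧ * ⟦ suc c ≟ suc k ⟧)  ≡⟨ ∑-single _ c q off-c out-of-range ⟩
  ⟦ suc c ∣? q ⟧ * ⟦ suc c ≟ suc c ⟧              ≡⟨ cong (⟦ suc c ∣? q ⟧ *_) (⟦⟧-yes (suc c ≟ suc c) refl) ⟩
  ⟦ suc c ∣? q ⟧ * 1                               ≡⟨ *-identityʳ _ ⟩
  ⟦ suc c ∣? q ⟧                                   ∎
  where
  open ≡-Reasoning
  off-c : ∀ k → k ≢ c → ⟦ suc k ∣? q ⟧ * ⟦ suc c ≟ suc k ⟧ ≡ 0
  off-c k k≢c = trans
    (cong (⟦ suc k ∣? q ⟧ *_) (⟦⟧-no (suc c ≟ suc k) (k≢c ∘ sym ∘ suc-injective)))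
    (*-zeroʳ ⟦ suc k ∣? q ⟧)
  out-of-range : q ≤ c → ⟦ suc c ∣? q ⟧ * ⟦ suc c ≟ suc c ⟧ ≡ 0
  out-of-range q≤c = cong (_* _) (⟦⟧-no (suc c ∣? q) λ c+1∣q → <⇒≱ (s≤s q≤c) (∣⇒≤ c+1∣q))

∑[gcd∣q]≡divisorSum : ∀ n .{{_ : NonZero n}} q .{{_ : NonZero q}} → q ∣ n →
  ∑[ y < n ] ⟦ gcd y n ∣? q ⟧ ≡ divisorSum q (λ d → φ (n / d))
∑[gcd∣q]≡divisorSum n q q∣n = begin
  ∑[ y < n ] ⟦ gcd y n ∣? q ⟧
    ≡⟨ ∑-cong n (λ y → ∑[d∣q]⟦g≡d⟧≡⟦g∣q⟧ q (gcd y n)) ⟨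
  ∑[ y < n ] ∑[ k < q ] (⟦ suc k ∣? q ⟧ * ⟦ gcd y n ≟ suc k ⟧)
    ≡⟨ ∑-comm n q _ ⟩
  ∑[ k < q ] ∑[ y < n ] (⟦ suc k ∣? q ⟧ * ⟦ gcd y n ≟ suc k ⟧)
    ≡⟨ ∑-cong q (λ k → *-distribˡ-∑ ⟦ suc k ∣? q ⟧ _ n) ⟨
  ∑[ k < q ] (⟦ suc k ∣? q ⟧ * ∑[ y < n ] ⟦ gcd y n ≟ suc k ⟧)
    ≡⟨ ∑-cong q (λ k → ⟦⟧-*-cong (suc k ∣? q) λ k+1∣q →
         ∑[gcd≡d]≡φ (suc k) (n / suc k) n (m/n*n≡m (∣-trans k+1∣q q∣n))) ⟩
  ∑[ k < q ] (⟦ suc k ∣? q ⟧ * φ (n / suc k))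
    ≡⟨ divisorSum≡∑ q (λ d → φ (n / d)) ⟨
  divisorSum q (λ d → φ (n / d)) ∎
  where open ≡-Reasoning

-- For x with gcd x n ≡ q: y is not a generator of ⟨x⟩, and y is a power of x or x is a power of y.
NbhdCond : ℕ → ℕ → ℕ → Set
NbhdCond n q y = gcd y n ≢ q × (q ∣ y ⊎ gcd y n ∣ q)

NbhdCond? : ∀ n q y → Dec (NbhdCond n q y)
NbhdCond? n q y = ¬? (gcd y n ≟ q) ×-dec (q ∣? y ⊎-dec gcd y n ∣? q)

∑[NbhdCond] : ∀ n .{{_ : NonZero n}} o q → o * q ≡ n →
  ∑[ y < n ] ⟦ NbhdCond? n q y ⟧ + 2 * φ o ≡ o + divisorSum q (λ d → φ (n / d))
∑[NbhdCond] n o q o*q≡n = begin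
  ∑[ y < n ] nbhd y + 2 * φ o
    ≡⟨ cong (λ t → ∑[ y < n ] nbhd y + 2 * t) (∑[gcd≡d]≡φ q o n o*q≡n) ⟨
  ∑[ y < n ] nbhd y + 2 * ∑[ y < n ] gen y
    ≡⟨ cong (∑[ y < n ] nbhd y +_) (*-distribˡ-∑ 2 gen n) ⟩
  ∑[ y < n ] nbhd y + ∑[ y < n ] (2 * gen y)
    ≡⟨ ∑-distrib-+ nbhd (λ y → 2 * gen y) n ⟨
  ∑[ y < n ] (nbhd y + 2 * gen y)
    ≡⟨ ∑-cong n (λ y → ⟦⟧-inclusion-exclusion (gcd y n ≟ q) (q ∣? y) (gcd y n ∣? q) (gcd≡q⇔ y)) ⟩
  ∑[ y < n ] (power y + root y)
    ≡⟨ ∑-distrib-+ power root n ⟩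
  ∑[ y < n ] power y + ∑[ y < n ] root y
    ≡⟨ cong₂ _+_ (subst (λ N → ∑[ y < N ] power y ≡ o) o*q≡n (∑[d∣y]≡m q o))
                 (∑[gcd∣q]≡divisorSum n q q∣n) ⟩
  o + divisorSum q (λ d → φ (n / d)) ∎
  where
  open ≡-Reasoning
  instance
    _ : NonZero q
    _ = m*n≢0⇒n≢0 o {{subst NonZero (sym o*q≡n) it}}
  nbhd gen power root : ℕ → ℕ
  nbhd  y = ⟦ NbhdCond? n q y ⟧
  gen   y = ⟦ gcd y n ≟ q ⟧
  power y = ⟦ q ∣? y ⟧
  root  y = ⟦ gcd y n ∣? q ⟧
  q∣n : q ∣ n
  q∣n = divides o (sym o*q≡n)
  gcd≡q⇔ : ∀ y → gcd y n ≡ q ⇔ (q ∣ y × gcd y n ∣ q)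
  gcd≡q⇔ y = mk⇔
    (λ { refl → gcd[m,n]∣m y n , ∣-refl })
    (λ (q∣y , gcd∣q) → ∣-antisym gcd∣q (gcd-greatest q∣y q∣n))

-- The cyclic group ℤ/nℤ

module _ (n : ℕ) .{{_ : NonZero n}} where

  open Cyclic n

  gcdₙ : C → ℕ
  gcdₙ y = gcd (toℕ y) n

  toℕ-pow : ∀ k y → toℕ (pow k y) ≡ k * toℕ y % n
  toℕ-pow zero    y = toℕ-fromℕ< _
  toℕ-pow (suc k) y = begin
    toℕ (y ⊕ pow k y)               ≡⟨ toℕ-fromℕ< _ ⟩
    (a + toℕ (pow k y)) % n         ≡⟨ cong (λ t → (a + t) % n) (toℕ-pow k y) ⟩
    (a + b % n) % n                 ≡⟨ [m+kn]%n≡m%n (a + b % n) (b / n) n ⟨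
    (a + b % n + b / n * n) % n     ≡⟨ cong (_% n) (+-assoc a (b % n) _) ⟩
    (a + (b % n + b / n * n)) % n   ≡⟨ cong (λ t → (a + t) % n) (m≡m%n+[m/n]*n b n) ⟨
    (a + b) % n                     ∎
    where
    open ≡-Reasoning
    a b : ℕ
    a = toℕ y
    b = k * a

  toℕ-e : toℕ e ≡ 0
  toℕ-e = trans (toℕ-fromℕ< _) (m<n⇒m%n≡m (>-nonZero⁻¹ n))

  pow≡⇔ : ∀ k y z → pow k y ≡ z ⇔ k * toℕ y % n ≡ toℕ z
  pow≡⇔ k y z = mk⇔
    (λ eq → trans (sym (toℕ-pow k y)) (cong toℕ eq))
    (λ eq → toℕ-injective (trans (toℕ-pow k y) eq))

  pow≡e⇔ : ∀ k y → pow k y ≡ e ⇔ n ∣ k * toℕ y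
  pow≡e⇔ k y = mk⇔
    (λ eq → m%n≡0⇒n∣m _ n (trans (pow≡⇔ k y e .to eq) toℕ-e))
    (λ n∣ → pow≡⇔ k y e .from (trans (n∣m⇒m%n≡0 _ n n∣) (sym toℕ-e)))

  bézout-mod : ∀ a → ∃ λ k → k * a % n ≡ gcd a n % n
  bézout-mod a with Bézout.identity (gcd-GCD a n)
  ... | Bézout.+- x y g+yn≡xa = x , (begin
    x * a % n            ≡⟨ cong (_% n) g+yn≡xa ⟨
    (g + y * n) % n      ≡⟨ [m+kn]%n≡m%n g y n ⟩
    g % n                ∎)
    where
    open ≡-Reasoning
    g = gcd a n
  -- Here g ≡ − x·a (mod n), and − x ≡ (n ∸ 1)·x.
  ... | Bézout.-+ x y g+xa≡yn = (n ∸ 1) * x , (begin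
    (n ∸ 1) * x * a % n                   ≡⟨ [m+kn]%n≡m%n _ y n ⟨
    ((n ∸ 1) * x * a + y * n) % n         ≡⟨ cong (λ t → ((n ∸ 1) * x * a + t) % n) g+xa≡yn ⟨
    ((n ∸ 1) * x * a + (g + x * a)) % n   ≡⟨ cong (_% n) (rearrange (n ∸ 1) x a g) ⟩
    (g + x * a * (n ∸ 1 + 1)) % n         ≡⟨ cong (λ t → (g + x * a * t) % n) (m∸n+n≡m (>-nonZero⁻¹ n)) ⟩
    (g + x * a * n) % n                   ≡⟨ [m+kn]%n≡m%n g (x * a) n ⟩
    g % n                                 ∎)
    where
    open ≡-Reasoning
    g = gcd a n
    rearrange : ∀ p x a g → p * x * a + (g + x * a) ≡ g + x * a * (p + 1)
    rearrange = solve-∀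

  InSub⇔gcdₙ∣ : ∀ y z → InSub y z ⇔ gcdₙ y ∣ toℕ z
  InSub⇔gcdₙ∣ y z = mk⇔ InSub⇒ ⇒InSub
    where
    open ≡-Reasoning
    a = toℕ y
    InSub⇒ : InSub y z → gcdₙ y ∣ toℕ z
    InSub⇒ (k , refl) = subst (gcdₙ y ∣_) (sym (toℕ-pow k y))
      (%-presˡ-∣ (∣-trans (gcd[m,n]∣m a n) (n∣m*n k)) (gcd[m,n]∣n a n))
    ⇒InSub : gcdₙ y ∣ toℕ z → InSub y z
    ⇒InSub (divides c z≡c*g) with bézout-mod a
    ... | k , ka≡g = c * k , pow≡⇔ (c * k) y z .from (begin
      c * k * a % n                  ≡⟨ cong (_% n) (*-assoc c k a) ⟩
      c * (k * a) % n                ≡⟨ %-distribˡ-* c (k * a) n ⟩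
      c % n * (k * a % n) % n        ≡⟨ cong (λ t → c % n * t % n) ka≡g ⟩
      c % n * (gcdₙ y % n) % n       ≡⟨ %-distribˡ-* c (gcdₙ y) n ⟨
      c * gcdₙ y % n                 ≡⟨ cong (_% n) z≡c*g ⟨
      toℕ z % n                      ≡⟨ m<n⇒m%n≡m (toℕ<n z) ⟩
      toℕ z                          ∎)

  InSub⇔gcdₙ∣gcdₙ : ∀ y z → InSub y z ⇔ gcdₙ y ∣ gcdₙ z
  InSub⇔gcdₙ∣gcdₙ y z = ⇔-trans (InSub⇔gcdₙ∣ y z) (mk⇔
    (λ g∣z → gcd-greatest g∣z (gcd[m,n]∣n (toℕ y) n))
    (λ g∣g → ∣-trans g∣g (gcd[m,n]∣m (toℕ z) n)))

  PosPow⇔InSub : ∀ y z → PosPow y z ⇔ InSub y z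
  PosPow⇔InSub y z = mk⇔ (λ (k , _ , eq) → k , eq) InSub⇒PosPow
    where
    InSub⇒PosPow : InSub y z → PosPow y z
    InSub⇒PosPow (zero , refl) = n , >-nonZero⁻¹ n , pow≡e⇔ n y .from (m∣m*n (toℕ y))
    InSub⇒PosPow (suc k , eq)  = suc k , s≤s z≤n , eq

  Gen⇔gcdₙ≡ : ∀ x y → Gen x y ⇔ gcdₙ y ≡ gcdₙ x
  Gen⇔gcdₙ≡ x y = mk⇔ Gen⇒≡ ≡⇒Gen
    where
    Gen⇒≡ : Gen x y → gcdₙ y ≡ gcdₙ x
    Gen⇒≡ gen = ∣-antisym
      (InSub⇔gcdₙ∣gcdₙ y x .to (gen x .from (InSub⇔gcdₙ∣gcdₙ x x .from ∣-refl)))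
      (InSub⇔gcdₙ∣gcdₙ x y .to (gen y .to (InSub⇔gcdₙ∣gcdₙ y y .from ∣-refl)))
    ≡⇒Gen : gcdₙ y ≡ gcdₙ x → Gen x y
    ≡⇒Gen eq z = mk⇔
      (InSub⇔gcdₙ∣ x z .from ∘ subst (_∣ toℕ z) eq ∘ InSub⇔gcdₙ∣ y z .to)
      (InSub⇔gcdₙ∣ y z .from ∘ subst (_∣ toℕ z) (sym eq) ∘ InSub⇔gcdₙ∣ x z .to)

  IsOrder⇒gcdₙ≡ : ∀ x o q → IsOrder x o → o * q ≡ n → gcdₙ x ≡ q
  IsOrder⇒gcdₙ≡ x o q (1≤o , xᵒ≡e , minimal) o*q≡n = ≤-antisym g≤q (∣⇒≤ q∣g)
    where
    a = toℕ x
    g = gcdₙ x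
    instance
      _ : NonZero o
      _ = >-nonZero 1≤o
      _ : NonZero g
      _ = ≢-nonZero (gcd[m,n]≢0 a n (inj₂ (≢-nonZero⁻¹ n)))
    q∣g : q ∣ g
    q∣g = gcd-greatest
      (*-cancelˡ-∣ o (subst (_∣ o * a) (sym o*q≡n) (pow≡e⇔ o x .to xᵒ≡e)))
      (divides o (sym o*q≡n))
    g≤q : g ≤ q
    g≤q with gcd[m,n]∣m a n | gcd[m,n]∣n a n
    ... | divides a′ a≡a′g | divides n′ n≡n′g = *-cancelˡ-≤ o (begin
      o * g    ≤⟨ *-monoˡ-≤ g (minimal n′ 1≤n′ (pow≡e⇔ n′ x .from n∣n′a)) ⟩
      n′ * g   ≡⟨ n≡n′g ⟨
      n        ≡⟨ o*q≡n ⟨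
      o * q    ∎)
      where
      open ≤-Reasoning
      1≤n′ : 1 ≤ n′
      1≤n′ = n≢0⇒n>0 λ n′≡0 → ≢-nonZero⁻¹ n (trans n≡n′g (cong (_* g) n′≡0))
      n∣n′a : n ∣ n′ * a
      n∣n′a = divides a′ (begin-equality
        n′ * a          ≡⟨ cong (n′ *_) a≡a′g ⟩
        n′ * (a′ * g)   ≡⟨ x∙yz≈y∙xz n′ a′ g ⟩
        a′ * (n′ * g)   ≡⟨ cong (a′ *_) n≡n′g ⟨
        a′ * n          ∎)

  Nbhd[Gen]⇔NbhdCond : ∀ x q → gcdₙ x ≡ q → ∀ y → Nbhd (Gen x) y ⇔ NbhdCond n q (toℕ y)
  Nbhd[Gen]⇔NbhdCond x q gₓ≡q y = mk⇔ Nbhd⇒ ⇒Nbhd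
    where
    Gen⇔gcdₙ≡q : ∀ z → Gen x z ⇔ gcdₙ z ≡ q
    Gen⇔gcdₙ≡q z = ⇔-trans (Gen⇔gcdₙ≡ x z)
      (mk⇔ (λ eq → trans eq gₓ≡q) (λ eq → trans eq (sym gₓ≡q)))
    PosPow⇔gcdₙ∣ : ∀ z w → PosPow z w ⇔ gcdₙ z ∣ toℕ w
    PosPow⇔gcdₙ∣ z w = ⇔-trans (PosPow⇔InSub z w) (InSub⇔gcdₙ∣ z w)
    PosPow⇔gcdₙ∣gcdₙ : ∀ z w → PosPow z w ⇔ gcdₙ z ∣ gcdₙ w
    PosPow⇔gcdₙ∣gcdₙ z w = ⇔-trans (PosPow⇔InSub z w) (InSub⇔gcdₙ∣gcdₙ z w)

    Nbhd⇒ : Nbhd (Gen x) y → NbhdCond n q (toℕ y)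
    Nbhd⇒ (¬gen , z , gen , _ , adj) = ¬gen ∘ Gen⇔gcdₙ≡q y .from ,
      ⊎-map (subst (_∣ toℕ y) gz≡q ∘ PosPow⇔gcdₙ∣ z y .to)
            (subst (gcdₙ y ∣_) gz≡q ∘ PosPow⇔gcdₙ∣gcdₙ y z .to) adj
      where
      gz≡q : gcdₙ z ≡ q
      gz≡q = Gen⇔gcdₙ≡q z .to gen

    ⇒Nbhd : NbhdCond n q (toℕ y) → Nbhd (Gen x) y
    ⇒Nbhd (gy≢q , adj) = gy≢q ∘ Gen⇔gcdₙ≡q y .to , x , Gen⇔gcdₙ≡ x x .from refl ,
      (λ x≡y → gy≢q (subst (λ w → gcdₙ w ≡ q) x≡y gₓ≡q)) ,
      ⊎-map (PosPow⇔gcdₙ∣ x y .from ∘ subst (_∣ toℕ y) (sym gₓ≡q))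
            (PosPow⇔gcdₙ∣gcdₙ y x .from ∘ subst (gcdₙ y ∣_) (sym gₓ≡q)) adj

mainTheorem2 : (n : ℕ) .{{nz : NonZero n}} → (x : Cyclic.C n) → (o : ℕ)
    → Cyclic.IsOrder n x o
    → (q : ℕ) → o * q ≡ n
    → ∃ λ m → HasSize (Cyclic.Nbhd n (Cyclic.Gen n x)) m
        × m + 2 * φ o ≡ o + divisorSum q (λ d → φ (n / d))
mainTheorem2 n x o ord q o*q≡n =
  length (filter (NbhdCond? n q ∘ toℕ) (allFin n)) ,
  HasSize-filter (NbhdCond? n q ∘ toℕ)
    (Nbhd[Gen]⇔NbhdCond n x q (IsOrder⇒gcdₙ≡ n x o q ord o*q≡n)) ,
  trans (cong (_+ 2 * φ o) (length-filter-allFin n (NbhdCond? n q))) (∑[NbhdCond] n o q o*q≡n)
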